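{- For $n\ge1$, there is an involution on the set of free Schröder paths of length $2n$ containing at least one up step that reverses the parity of the number of flaw blocks; consequently \[\sum_{i=0}^{n}(-1)^i\,a(n-i,2i+1)=1.\]
   Context: A free Schröder path of length $2n$ is a lattice path from $(0,0)$ to $(2n,0)$ with steps $U=(1,1)$, $H=(2,0)$, $D=(1,-1)$. A flaw block is a maximal segment that starts and ends on the $x$-axis and is otherwise strictly below it; their number equals the number of $D$ steps from height $0$ to $-1$. Let $S=S(x)$ be the power series determined by $S=1+xS+xS^2$ (generating function of the large Schröder numbers), and $a(n,k)=[x^n]S^k$ the coefficient of $x^n$ in $S^k$, with $a(0,k)=1$. -}

module Defs where

open import Data.Nat using (ℕ; zero; suc; _+_; _*_; _∸_)
open import Data.Integer as ℤ using (ℤ; 0ℤ; 1ℤ; -1ℤ)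
open import Data.Nat.ListAction using (sum)
open import Data.List using (List; []; _∷_; map; upTo; zipWith; reverse)
open import Data.List.Relation.Unary.Any using (Any)
open import Data.Bool using (if_then_else_)
open import Relation.Nullary using (does)
open import Relation.Binary.PropositionalEquality using (_≡_)
open import Data.Product using (Σ; _×_)

-- Steps of a Schröder path: U = (1,1), H = (2,0), D = (1,-1)

data Step : Set where
  U H D : Step

xlen : List Step → ℕ
xlen []      = 0
xlen (U ∷ p) = 1 + xlen p
xlen (H ∷ p) = 2 + xlen p
xlen (D ∷ p) = 1 + xlen p

heightFrom : ℤ → List Step → ℤ
heightFrom h []      = h
heightFrom h (U ∷ p) = heightFrom (h ℤ.+ 1ℤ) p
heightFrom h (H ∷ p) = heightFrom h p
heightFrom h (D ∷ p) = heightFrom (h ℤ.- 1ℤ) p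

-- free Schröder path of length 2n: from (0,0) to (2n,0), any heights allowed
FreeSchroder : ℕ → List Step → Set
FreeSchroder n p = (xlen p ≡ 2 * n) × (heightFrom 0ℤ p ≡ 0ℤ)

HasUp : List Step → Set
HasUp p = Any (_≡ U) p

flawsFrom : ℤ → List Step → ℕ
flawsFrom h []      = 0
flawsFrom h (U ∷ p) = flawsFrom (h ℤ.+ 1ℤ) p
flawsFrom h (H ∷ p) = flawsFrom h p
flawsFrom h (D ∷ p) = (if does (h ℤ.≟ 0ℤ) then 1 else 0) + flawsFrom (h ℤ.- 1ℤ) p

-- number of flaw blocks of a path (= number of D steps from height 0 to -1)
flawBlocks : List Step → ℕ
flawBlocks = flawsFrom 0ℤ

FreeSchroderWithUp : ℕ → Set
FreeSchroderWithUp n = Σ (List Step) (λ p → FreeSchroder n p × HasUp p)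

-- Power series S = 1 + x S + x S², coefficients = large Schröder numbers.
-- [x^0]S = 1, [x^(m+1)]S = [x^m]S + Σ_{k=0}^{m} [x^k]S · [x^(m-k)]S.

headOr0 : List ℕ → ℕ
headOr0 []      = 0
headOr0 (x ∷ _) = x

-- schRev m = [ r_m , r_(m-1) , … , r_0 ]
schRev : ℕ → List ℕ
schRev zero    = 1 ∷ []
schRev (suc m) = (headOr0 l + sum (zipWith _*_ l (reverse l))) ∷ l
  where l = schRev m

schroder : ℕ → ℕ
schroder m = headOr0 (schRev m)

-- coefficient of x^m in S^k
powCoeff : ℕ → ℕ → ℕ
powCoeff zero    zero    = 1
powCoeff zero    (suc m) = 0
powCoeff (suc k) m       = sum (map (λ i → schroder i * powCoeff k (m ∸ i)) (upTo (suc m)))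

a : ℕ → ℕ → ℤ
a n k = ℤ.+ (powCoeff k n)

sumℤ : List ℤ → ℤ
sumℤ []       = 0ℤ
sumℤ (x ∷ xs) = x ℤ.+ sumℤ xs

altSum : ℕ → ℤ
altSum n = sumℤ (map (λ i → (-1ℤ ℤ.^ i) ℤ.* a (n ∸ i) (2 * i + 1)) (upTo (suc n)))

module Submission where

-- Reflecting the first block of a path in the axis (the segment from its first non-horizontal
-- step to its first return to the axis) exchanges U and D on that segment only. This is an
-- involution that keeps both endpoints and turns a flaw block into a block above the axis or
-- vice versa, so the number of flaw blocks changes by exactly one. An up step guarantees a
-- non-horizontal block, and the reflected path has one too: a block above the axis ends with
-- a D, which becomes a U.
--
-- For the identity let A(n,k) = Σ_i (-1)^i a(n-i,2i+k). Multiplying S = 1 + xS + xS² by S^k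
-- gives a(m+1,k+1) = a(m,k+1) + a(m+1,k) + a(m,k+2); summed with signs this yields
-- A(n+1,1) = A(n,1) + A(n+1,0) + A(n,2), while a(m+1,0) = 0 gives A(n+1,0) = -A(n,2).
-- Hence A(n,1) = A(0,1) = 1.

open import Defs
open import Data.Nat using (ℕ; zero; suc; _+_; _*_; _∸_; _≤_; _%_)
import Data.Nat.Properties as ℕ
import Data.Nat.ListAction as ℕ
open import Data.Nat.DivMod using ([m+n]%n≡m%n)
open import Data.Integer as ℤ using (ℤ; +[1+_]; -[1+_]; 0ℤ; 1ℤ; -1ℤ)
import Data.Integer.Properties as ℤ
open import Data.Integer.Tactic.RingSolver using (solve-∀)
open import Data.Fin using (Fin; toℕ)
open import Data.Fin.Properties using (toℕ-inject₁; toℕ-fromℕ; toℕ≤pred[n])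
open import Data.List using (List; []; _∷_; applyUpTo; zipWith; reverse; _∷ʳ_)
import Data.List.Properties as List
open import Data.List.Relation.Unary.Any using (here; there)
open import Data.Product using (Σ; _×_; _,_; proj₁)
open import Data.Sum using (_⊎_; inj₁; inj₂)
open import Algebra.Bundles using (Monoid)
open import Function using (_∘_)
open import Relation.Binary.PropositionalEquality
open ≡-Reasoning

+[1+n]+1≡+[2+n] : ∀ n → +[1+ n ] ℤ.+ 1ℤ ≡ +[1+ suc n ]
+[1+n]+1≡+[2+n] n = cong +[1+_] (ℕ.+-comm n 1)

-[1+n]-1≡-[2+n] : ∀ n → -[1+ n ] ℤ.- 1ℤ ≡ -[1+ suc n ]
-[1+n]-1≡-[2+n] n = cong (λ k → -[1+ suc k ]) (ℕ.+-identityʳ n)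

-[1+n]+1≡-n : ∀ n → -[1+ n ] ℤ.+ 1ℤ ≡ ℤ.- (ℤ.+ n)
-[1+n]+1≡-n zero    = refl
-[1+n]+1≡-n (suc n) = refl

-- In reflectAbove d p the path p starts at height d; its steps are reflected up to its
-- first return to the axis, after which it is kept unchanged.
reflectAbove : ℕ → List Step → List Step
reflectAbove zero    p       = p
reflectAbove (suc d) []      = []
reflectAbove (suc d) (U ∷ p) = D ∷ reflectAbove (suc (suc d)) p
reflectAbove (suc d) (H ∷ p) = H ∷ reflectAbove (suc d) p
reflectAbove (suc d) (D ∷ p) = U ∷ reflectAbove d p

reflectBelow : ℕ → List Step → List Step
reflectBelow zero    p       = p
reflectBelow (suc d) []      = []
reflectBelow (suc d) (D ∷ p) = U ∷ reflectBelow (suc (suc d)) p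
reflectBelow (suc d) (H ∷ p) = H ∷ reflectBelow (suc d) p
reflectBelow (suc d) (U ∷ p) = D ∷ reflectBelow d p

reflectFirstBlock : List Step → List Step
reflectFirstBlock []      = []
reflectFirstBlock (H ∷ p) = H ∷ reflectFirstBlock p
reflectFirstBlock (U ∷ p) = D ∷ reflectAbove 1 p
reflectFirstBlock (D ∷ p) = U ∷ reflectBelow 1 p

reflectBelow-reflectAbove : ∀ d p → reflectBelow d (reflectAbove d p) ≡ p
reflectBelow-reflectAbove zero    p       = refl
reflectBelow-reflectAbove (suc d) []      = refl
reflectBelow-reflectAbove (suc d) (U ∷ p) = cong (U ∷_) (reflectBelow-reflectAbove (suc (suc d)) p)
reflectBelow-reflectAbove (suc d) (H ∷ p) = cong (H ∷_) (reflectBelow-reflectAbove (suc d) p)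
reflectBelow-reflectAbove (suc d) (D ∷ p) = cong (D ∷_) (reflectBelow-reflectAbove d p)

reflectAbove-reflectBelow : ∀ d p → reflectAbove d (reflectBelow d p) ≡ p
reflectAbove-reflectBelow zero    p       = refl
reflectAbove-reflectBelow (suc d) []      = refl
reflectAbove-reflectBelow (suc d) (D ∷ p) = cong (D ∷_) (reflectAbove-reflectBelow (suc (suc d)) p)
reflectAbove-reflectBelow (suc d) (H ∷ p) = cong (H ∷_) (reflectAbove-reflectBelow (suc d) p)
reflectAbove-reflectBelow (suc d) (U ∷ p) = cong (U ∷_) (reflectAbove-reflectBelow d p)

reflectFirstBlock-involutive : ∀ p → reflectFirstBlock (reflectFirstBlock p) ≡ p
reflectFirstBlock-involutive []      = refl
reflectFirstBlock-involutive (H ∷ p) = cong (H ∷_) (reflectFirstBlock-involutive p)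
reflectFirstBlock-involutive (U ∷ p) = cong (U ∷_) (reflectBelow-reflectAbove 1 p)
reflectFirstBlock-involutive (D ∷ p) = cong (D ∷_) (reflectAbove-reflectBelow 1 p)

xlen-reflectAbove : ∀ d p → xlen (reflectAbove d p) ≡ xlen p
xlen-reflectAbove zero    p       = refl
xlen-reflectAbove (suc d) []      = refl
xlen-reflectAbove (suc d) (U ∷ p) = cong suc (xlen-reflectAbove (suc (suc d)) p)
xlen-reflectAbove (suc d) (H ∷ p) = cong (suc ∘ suc) (xlen-reflectAbove (suc d) p)
xlen-reflectAbove (suc d) (D ∷ p) = cong suc (xlen-reflectAbove d p)

xlen-reflectBelow : ∀ d p → xlen (reflectBelow d p) ≡ xlen p
xlen-reflectBelow zero    p       = refl
xlen-reflectBelow (suc d) []      = refl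
xlen-reflectBelow (suc d) (D ∷ p) = cong suc (xlen-reflectBelow (suc (suc d)) p)
xlen-reflectBelow (suc d) (H ∷ p) = cong (suc ∘ suc) (xlen-reflectBelow (suc d) p)
xlen-reflectBelow (suc d) (U ∷ p) = cong suc (xlen-reflectBelow d p)

xlen-reflectFirstBlock : ∀ p → xlen (reflectFirstBlock p) ≡ xlen p
xlen-reflectFirstBlock []      = refl
xlen-reflectFirstBlock (H ∷ p) = cong (suc ∘ suc) (xlen-reflectFirstBlock p)
xlen-reflectFirstBlock (U ∷ p) = cong suc (xlen-reflectAbove 1 p)
xlen-reflectFirstBlock (D ∷ p) = cong suc (xlen-reflectBelow 1 p)

heightFrom-reflectAbove : ∀ d p → heightFrom (ℤ.+ d) p ≡ 0ℤ →
                          heightFrom (ℤ.- (ℤ.+ d)) (reflectAbove d p) ≡ 0ℤ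
heightFrom-reflectAbove zero    p       returns = returns
heightFrom-reflectAbove (suc d) (U ∷ p) returns
  rewrite +[1+n]+1≡+[2+n] d | -[1+n]-1≡-[2+n] d = heightFrom-reflectAbove (suc (suc d)) p returns
heightFrom-reflectAbove (suc d) (H ∷ p) returns = heightFrom-reflectAbove (suc d) p returns
heightFrom-reflectAbove (suc d) (D ∷ p) returns
  rewrite -[1+n]+1≡-n d = heightFrom-reflectAbove d p returns

heightFrom-reflectBelow : ∀ d p → heightFrom (ℤ.- (ℤ.+ d)) p ≡ 0ℤ →
                          heightFrom (ℤ.+ d) (reflectBelow d p) ≡ 0ℤ
heightFrom-reflectBelow zero    p       returns = returns
heightFrom-reflectBelow (suc d) (D ∷ p) returns
  rewrite +[1+n]+1≡+[2+n] d | -[1+n]-1≡-[2+n] d = heightFrom-reflectBelow (suc (suc d)) p returns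
heightFrom-reflectBelow (suc d) (H ∷ p) returns = heightFrom-reflectBelow (suc d) p returns
heightFrom-reflectBelow (suc d) (U ∷ p) returns
  rewrite -[1+n]+1≡-n d = heightFrom-reflectBelow d p returns

heightFrom-reflectFirstBlock : ∀ p → heightFrom 0ℤ p ≡ 0ℤ →
                               heightFrom 0ℤ (reflectFirstBlock p) ≡ 0ℤ
heightFrom-reflectFirstBlock []      returns = returns
heightFrom-reflectFirstBlock (H ∷ p) returns = heightFrom-reflectFirstBlock p returns
heightFrom-reflectFirstBlock (U ∷ p) returns = heightFrom-reflectAbove 1 p returns
heightFrom-reflectFirstBlock (D ∷ p) returns = heightFrom-reflectBelow 1 p returns

flawsFrom-reflectAbove : ∀ d p → flawsFrom (ℤ.- (ℤ.+ d)) (reflectAbove d p) ≡ flawsFrom (ℤ.+ d) p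
flawsFrom-reflectAbove zero    p       = refl
flawsFrom-reflectAbove (suc d) []      = refl
flawsFrom-reflectAbove (suc d) (U ∷ p)
  rewrite +[1+n]+1≡+[2+n] d | -[1+n]-1≡-[2+n] d = flawsFrom-reflectAbove (suc (suc d)) p
flawsFrom-reflectAbove (suc d) (H ∷ p) = flawsFrom-reflectAbove (suc d) p
flawsFrom-reflectAbove (suc d) (D ∷ p) rewrite -[1+n]+1≡-n d = flawsFrom-reflectAbove d p

flawsFrom-reflectBelow : ∀ d p → flawsFrom (ℤ.+ d) (reflectBelow d p) ≡ flawsFrom (ℤ.- (ℤ.+ d)) p
flawsFrom-reflectBelow zero    p       = refl
flawsFrom-reflectBelow (suc d) []      = refl
flawsFrom-reflectBelow (suc d) (D ∷ p)
  rewrite +[1+n]+1≡+[2+n] d | -[1+n]-1≡-[2+n] d = flawsFrom-reflectBelow (suc (suc d)) p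
flawsFrom-reflectBelow (suc d) (H ∷ p) = flawsFrom-reflectBelow (suc d) p
flawsFrom-reflectBelow (suc d) (U ∷ p) rewrite -[1+n]+1≡-n d = flawsFrom-reflectBelow d p

flawBlocks-reflectFirstBlock : ∀ p → HasUp p →
  flawBlocks (reflectFirstBlock p) ≡ suc (flawBlocks p) ⊎
  flawBlocks p ≡ suc (flawBlocks (reflectFirstBlock p))
flawBlocks-reflectFirstBlock (H ∷ p) (there up) = flawBlocks-reflectFirstBlock p up
flawBlocks-reflectFirstBlock (U ∷ p) _          = inj₁ (cong suc (flawsFrom-reflectAbove 1 p))
flawBlocks-reflectFirstBlock (D ∷ p) _          = inj₂ (cong suc (sym (flawsFrom-reflectBelow 1 p)))

HasUp-reflectAbove : ∀ d p → heightFrom +[1+ d ] p ≡ 0ℤ → HasUp (reflectAbove (suc d) p)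
HasUp-reflectAbove d (U ∷ p) returns
  rewrite +[1+n]+1≡+[2+n] d = there (HasUp-reflectAbove (suc d) p returns)
HasUp-reflectAbove d (H ∷ p) returns = there (HasUp-reflectAbove d p returns)
HasUp-reflectAbove d (D ∷ p) _       = here refl

HasUp-reflectFirstBlock : ∀ p → heightFrom 0ℤ p ≡ 0ℤ → HasUp p → HasUp (reflectFirstBlock p)
HasUp-reflectFirstBlock (H ∷ p) returns (there up) = there (HasUp-reflectFirstBlock p returns up)
HasUp-reflectFirstBlock (U ∷ p) returns _          = there (HasUp-reflectAbove 0 p returns)
HasUp-reflectFirstBlock (D ∷ p) _       _          = here refl

[2+m]%2≡m%2 : ∀ m → suc (suc m) % 2 ≡ m % 2
[2+m]%2≡m%2 m = trans (cong (_% 2) (ℕ.+-comm 2 m)) ([m+n]%n≡m%n m 2)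

[1+m]%2≢m%2 : ∀ m → suc m % 2 ≢ m % 2
[1+m]%2≢m%2 zero    ()
[1+m]%2≢m%2 (suc m) eq = [1+m]%2≢m%2 m (sym (trans (sym ([2+m]%2≡m%2 m)) eq))

m≡1+n⊎n≡1+m⇒m%2≢n%2 : ∀ m n → m ≡ suc n ⊎ n ≡ suc m → m % 2 ≢ n % 2
m≡1+n⊎n≡1+m⇒m%2≢n%2 _ n (inj₁ refl) = [1+m]%2≢m%2 n
m≡1+n⊎n≡1+m⇒m%2≢n%2 m _ (inj₂ refl) = [1+m]%2≢m%2 m ∘ sym

reflectFirstBlockWithUp : ∀ {n} → FreeSchroderWithUp n → FreeSchroderWithUp n
reflectFirstBlockWithUp (p , (length , returns) , up) =
  reflectFirstBlock p ,
  (trans (xlen-reflectFirstBlock p) length , heightFrom-reflectFirstBlock p returns) ,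
  HasUp-reflectFirstBlock p returns up

module IndexedSum {a ℓ} (M : Monoid a ℓ) where
  open Monoid M using (Carrier; _≈_; _∙_) renaming (trans to ≈-trans; reflexive to ≈-reflexive)
  open import Algebra.Properties.Monoid.Sum M using (sum⁺-syntax; sum-init-last; sum-cong-≗)

  sum⁺-last : ∀ n (f : ℕ → Carrier) → ∑[ i ≤ suc n ] f (toℕ i) ≈ ∑[ i ≤ n ] f (toℕ i) ∙ f (suc n)
  sum⁺-last n f = ≈-trans (sum-init-last (f ∘ toℕ))
    (≈-reflexive (cong₂ _∙_ (sum-cong-≗ {suc n} (cong f ∘ toℕ-inject₁)) (cong f (toℕ-fromℕ (suc n)))))

module PowersOfS where

  open import Algebra.Properties.Semiring.Sum ℕ.+-*-semiring
    using (sum-syntax; sum⁺-syntax; sum-cong-≗; ∑-distrib-+; sum-replicate-zero)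
  open IndexedSum ℕ.+-0-monoid

  [1+m]∸i≡1+[m∸i] : ∀ {m} (i : Fin (suc m)) → suc m ∸ toℕ i ≡ suc (m ∸ toℕ i)
  [1+m]∸i≡1+[m∸i] i = ℕ.+-∸-assoc 1 (toℕ≤pred[n] i)

  sum-applyUpTo : ∀ n (f : ℕ → ℕ) → ℕ.sum (applyUpTo f n) ≡ ∑[ i < n ] f (toℕ i)
  sum-applyUpTo zero    f = refl
  sum-applyUpTo (suc n) f = cong (f 0 +_) (sum-applyUpTo n (f ∘ suc))

  infixl 7 _⋆_
  _⋆_ : (ℕ → ℕ) → (ℕ → ℕ) → ℕ → ℕ
  (f ⋆ g) m = ∑[ i ≤ m ] (f (toℕ i) * g (m ∸ toℕ i))

  timesX : (ℕ → ℕ) → ℕ → ℕ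
  timesX f zero    = 0
  timesX f (suc m) = f m

  ⋆-congˡ : ∀ f {g h} → g ≗ h → f ⋆ g ≗ f ⋆ h
  ⋆-congˡ f g≗h m = sum-cong-≗ {suc m} λ i → cong (f (toℕ i) *_) (g≗h (m ∸ toℕ i))

  ⋆-distribˡ-+ : ∀ f g h m → (f ⋆ (λ j → g j + h j)) m ≡ (f ⋆ g) m + (f ⋆ h) m
  ⋆-distribˡ-+ f g h m = trans
    (sum-cong-≗ {suc m} λ i → ℕ.*-distribˡ-+ (f (toℕ i)) (g (m ∸ toℕ i)) (h (m ∸ toℕ i)))
    (∑-distrib-+ {suc m} (λ i → f (toℕ i) * g (m ∸ toℕ i)) (λ i → f (toℕ i) * h (m ∸ toℕ i)))

  ⋆-timesXˡ : ∀ f g → f ⋆ timesX g ≗ timesX (f ⋆ g)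
  ⋆-timesXˡ f g zero    = trans (ℕ.+-identityʳ _) (ℕ.*-zeroʳ (f 0))
  ⋆-timesXˡ f g (suc m) = begin
    (f ⋆ timesX g) (suc m)
      ≡⟨ sum⁺-last m (λ j → f j * timesX g (suc m ∸ j)) ⟩
    ∑[ i ≤ m ] (f (toℕ i) * timesX g (suc m ∸ toℕ i)) + f (suc m) * timesX g (suc m ∸ suc m)
      ≡⟨ cong₂ _+_ (sum-cong-≗ {suc m} λ i → cong (λ j → f (toℕ i) * timesX g j) ([1+m]∸i≡1+[m∸i] i))
                   (trans (cong (λ j → f (suc m) * timesX g j) (ℕ.n∸n≡0 m)) (ℕ.*-zeroʳ (f (suc m)))) ⟩
    (f ⋆ g) m + 0
      ≡⟨ ℕ.+-identityʳ _ ⟩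
    (f ⋆ g) m ∎

  ⋆-identityʳ : ∀ f → f ⋆ powCoeff 0 ≗ f
  ⋆-identityʳ f zero    = trans (ℕ.+-identityʳ _) (ℕ.*-identityʳ (f 0))
  ⋆-identityʳ f (suc m) = begin
    (f ⋆ powCoeff 0) (suc m)
      ≡⟨ sum⁺-last m (λ j → f j * powCoeff 0 (suc m ∸ j)) ⟩
    ∑[ i ≤ m ] (f (toℕ i) * powCoeff 0 (suc m ∸ toℕ i)) + f (suc m) * powCoeff 0 (suc m ∸ suc m)
      ≡⟨ cong₂ _+_ (trans (sum-cong-≗ {suc m} λ i → trans (cong (λ j → f (toℕ i) * powCoeff 0 j) ([1+m]∸i≡1+[m∸i] i))
                                                  (ℕ.*-zeroʳ (f (toℕ i))))
                          (sum-replicate-zero (suc m)))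
                   (trans (cong (λ j → f (suc m) * powCoeff 0 j) (ℕ.n∸n≡0 m)) (ℕ.*-identityʳ (f (suc m)))) ⟩
    f (suc m) ∎

  timesX-cong : ∀ {f g} → f ≗ g → timesX f ≗ timesX g
  timesX-cong f≗g zero    = refl
  timesX-cong f≗g (suc m) = f≗g m

  powCoeff-suc : ∀ k → powCoeff (suc k) ≗ schroder ⋆ powCoeff k
  powCoeff-suc k m = trans (cong ℕ.sum (List.map-upTo g (suc m))) (sum-applyUpTo (suc m) g)
    where g = λ i → schroder i * powCoeff k (m ∸ i)

  powCoeff-one : powCoeff 1 ≗ schroder
  powCoeff-one m = trans (powCoeff-suc 0 m) (⋆-identityʳ schroder m)

  powCoeff-at-zero : ∀ k → powCoeff k 0 ≡ 1
  powCoeff-at-zero zero    = refl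
  powCoeff-at-zero (suc k) = begin
    powCoeff (suc k) 0          ≡⟨ powCoeff-suc k 0 ⟩
    (schroder ⋆ powCoeff k) 0   ≡⟨ ℕ.+-identityʳ _ ⟩
    1 * powCoeff k 0            ≡⟨ ℕ.*-identityˡ _ ⟩
    powCoeff k 0                ≡⟨ powCoeff-at-zero k ⟩
    1 ∎

  schRev-applyUpTo : ∀ m → schRev m ≡ applyUpTo (λ i → schroder (m ∸ i)) (suc m)
  schRev-applyUpTo zero    = refl
  schRev-applyUpTo (suc m) = cong (schroder (suc m) ∷_) (schRev-applyUpTo m)

  reverse-applyUpTo-∸ : ∀ (f : ℕ → ℕ) m →
    reverse (applyUpTo (λ i → f (m ∸ i)) (suc m)) ≡ applyUpTo f (suc m)
  reverse-applyUpTo-∸ f zero    = refl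
  reverse-applyUpTo-∸ f (suc m) = begin
    reverse (f (suc m) ∷ applyUpTo (λ i → f (m ∸ i)) (suc m))
      ≡⟨ List.unfold-reverse (f (suc m)) (applyUpTo (λ i → f (m ∸ i)) (suc m)) ⟩
    reverse (applyUpTo (λ i → f (m ∸ i)) (suc m)) ∷ʳ f (suc m)
      ≡⟨ cong (_∷ʳ f (suc m)) (reverse-applyUpTo-∸ f m) ⟩
    applyUpTo f (suc m) ∷ʳ f (suc m)
      ≡⟨ List.applyUpTo-∷ʳ f (suc m) ⟩
    applyUpTo f (suc (suc m)) ∎

  zipWith-applyUpTo : ∀ (_∙_ : ℕ → ℕ → ℕ) f g n →
    zipWith _∙_ (applyUpTo f n) (applyUpTo g n) ≡ applyUpTo (λ i → f i ∙ g i) n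
  zipWith-applyUpTo _∙_ f g zero    = refl
  zipWith-applyUpTo _∙_ f g (suc n) = cong (f 0 ∙ g 0 ∷_) (zipWith-applyUpTo _∙_ (f ∘ suc) (g ∘ suc) n)

  schroder-suc : ∀ m → schroder (suc m) ≡ schroder m + (schroder ⋆ schroder) m
  schroder-suc m = cong (schroder m +_) (begin
    ℕ.sum (zipWith _*_ (schRev m) (reverse (schRev m)))
      ≡⟨ cong (λ l → ℕ.sum (zipWith _*_ l (reverse l))) (schRev-applyUpTo m) ⟩
    ℕ.sum (zipWith _*_ (applyUpTo (λ i → schroder (m ∸ i)) (suc m))
                       (reverse (applyUpTo (λ i → schroder (m ∸ i)) (suc m))))
      ≡⟨ cong (ℕ.sum ∘ zipWith _*_ _) (reverse-applyUpTo-∸ schroder m) ⟩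
    ℕ.sum (zipWith _*_ (applyUpTo (λ i → schroder (m ∸ i)) (suc m)) (applyUpTo schroder (suc m)))
      ≡⟨ cong ℕ.sum (zipWith-applyUpTo _*_ (λ i → schroder (m ∸ i)) schroder (suc m)) ⟩
    ℕ.sum (applyUpTo (λ i → schroder (m ∸ i) * schroder i) (suc m))
      ≡⟨ sum-applyUpTo (suc m) (λ i → schroder (m ∸ i) * schroder i) ⟩
    ∑[ i ≤ m ] (schroder (m ∸ toℕ i) * schroder (toℕ i))
      ≡⟨ sum-cong-≗ {suc m} (λ i → ℕ.*-comm (schroder (m ∸ toℕ i)) (schroder (toℕ i))) ⟩
    (schroder ⋆ schroder) m ∎)

  -- S^(k+1) = x S^(k+1) + S^k + x S^(k+2): the defining equation S = 1 + x S + x S² times S^k.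
  powCoeff-functionalEquation : ∀ k m →
    powCoeff (suc k) m ≡ timesX (powCoeff (suc k)) m + powCoeff k m + timesX (powCoeff (suc (suc k))) m
  powCoeff-functionalEquation zero zero    = refl
  powCoeff-functionalEquation zero (suc m) = begin
    powCoeff 1 (suc m)                        ≡⟨ powCoeff-one (suc m) ⟩
    schroder (suc m)                          ≡⟨ schroder-suc m ⟩
    schroder m + (schroder ⋆ schroder) m      ≡⟨ cong₂ _+_ (sym (trans (ℕ.+-identityʳ _) (powCoeff-one m)))
                                                           (sym (trans (powCoeff-suc 1 m) (⋆-congˡ schroder powCoeff-one m))) ⟩
    powCoeff 1 m + 0 + powCoeff 2 m ∎
  powCoeff-functionalEquation (suc k) m = begin
    powCoeff (2 + k) m
      ≡⟨ powCoeff-suc (suc k) m ⟩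
    (schroder ⋆ powCoeff (suc k)) m
      ≡⟨ ⋆-congˡ schroder (powCoeff-functionalEquation k) m ⟩
    (schroder ⋆ (λ j → timesX (powCoeff (1 + k)) j + powCoeff k j + timesX (powCoeff (2 + k)) j)) m
      ≡⟨ ⋆-distribˡ-+ schroder (λ j → timesX (powCoeff (1 + k)) j + powCoeff k j) (timesX (powCoeff (2 + k))) m ⟩
    (schroder ⋆ (λ j → timesX (powCoeff (1 + k)) j + powCoeff k j)) m + (schroder ⋆ timesX (powCoeff (2 + k))) m
      ≡⟨ cong (_+ (schroder ⋆ timesX (powCoeff (2 + k))) m) (⋆-distribˡ-+ schroder (timesX (powCoeff (1 + k))) (powCoeff k) m) ⟩
    (schroder ⋆ timesX (powCoeff (1 + k))) m + (schroder ⋆ powCoeff k) m + (schroder ⋆ timesX (powCoeff (2 + k))) m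
      ≡⟨ cong₂ _+_ (cong₂ _+_ (trans (⋆-timesXˡ schroder _ m) (timesX-cong (sym ∘ powCoeff-suc (1 + k)) m))
                              (sym (powCoeff-suc k m)))
                   (trans (⋆-timesXˡ schroder _ m) (timesX-cong (sym ∘ powCoeff-suc (2 + k)) m)) ⟩
    timesX (powCoeff (2 + k)) m + powCoeff (1 + k) m + timesX (powCoeff (3 + k)) m ∎

open PowersOfS using (powCoeff-functionalEquation; powCoeff-at-zero)

open import Algebra.Properties.Semiring.Sum ℤ.+-*-semiring
  using (sum-syntax; sum⁺-syntax; sum-cong-≗; ∑-distrib-+; *-distribˡ-sum)
open IndexedSum ℤ.+-0-monoid

sumℤ-applyUpTo : ∀ n (f : ℕ → ℤ) → sumℤ (applyUpTo f n) ≡ ∑[ i < n ] f (toℕ i)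
sumℤ-applyUpTo zero    f = refl
sumℤ-applyUpTo (suc n) f = cong (λ s → f 0 ℤ.+ s) (sumℤ-applyUpTo n (f ∘ suc))

a-suc-suc : ∀ m k → a (suc m) (suc k) ≡ a m (suc k) ℤ.+ a (suc m) k ℤ.+ a m (suc (suc k))
a-suc-suc m k = cong ℤ.+_ (powCoeff-functionalEquation k (suc m))

a-zero : ∀ k → a 0 k ≡ 1ℤ
a-zero k = cong ℤ.+_ (powCoeff-at-zero k)

signedCoeff : ℕ → ℕ → ℕ → ℤ
signedCoeff n k i = -1ℤ ℤ.^ i ℤ.* a (n ∸ i) (2 * i + k)

alternatingSum : ℕ → ℕ → ℤ
alternatingSum n k = ∑[ i ≤ n ] signedCoeff n k (toℕ i)

altSum≡alternatingSum : ∀ n → altSum n ≡ alternatingSum n 1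
altSum≡alternatingSum n = trans (cong sumℤ (List.map-upTo (signedCoeff n 1) (suc n)))
                                (sumℤ-applyUpTo (suc n) (signedCoeff n 1))

signedCoeff-diagonal : ∀ n k → signedCoeff n k n ≡ -1ℤ ℤ.^ n
signedCoeff-diagonal n k = begin
  -1ℤ ℤ.^ n ℤ.* a (n ∸ n) (2 * n + k) ≡⟨ cong (λ m → -1ℤ ℤ.^ n ℤ.* a m (2 * n + k)) (ℕ.n∸n≡0 n) ⟩
  -1ℤ ℤ.^ n ℤ.* a 0 (2 * n + k)       ≡⟨ cong (-1ℤ ℤ.^ n ℤ.*_) (a-zero (2 * n + k)) ⟩
  -1ℤ ℤ.^ n ℤ.* 1ℤ                    ≡⟨ ℤ.*-identityʳ _ ⟩
  -1ℤ ℤ.^ n ∎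

signedCoeff-suc : ∀ n j → j ≤ n →
  signedCoeff (suc n) 1 j ≡ signedCoeff n 1 j ℤ.+ signedCoeff (suc n) 0 j ℤ.+ signedCoeff n 2 j
signedCoeff-suc n j j≤n
  rewrite ℕ.+-∸-assoc 1 j≤n | ℕ.+-comm (2 * j) 1 | ℕ.+-identityʳ (2 * j) | ℕ.+-comm (2 * j) 2
  = trans (cong (-1ℤ ℤ.^ j ℤ.*_) (a-suc-suc (n ∸ j) (2 * j))) (distrib₃ (-1ℤ ℤ.^ j) _ _ _)
  where
  distrib₃ : ∀ x y z w → x ℤ.* (y ℤ.+ z ℤ.+ w) ≡ x ℤ.* y ℤ.+ x ℤ.* z ℤ.+ x ℤ.* w
  distrib₃ = solve-∀

alternatingSum-suc-0 : ∀ n → alternatingSum (suc n) 0 ≡ -1ℤ ℤ.* alternatingSum n 2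
alternatingSum-suc-0 n = begin
  signedCoeff (suc n) 0 0 ℤ.+ ∑[ i ≤ n ] signedCoeff (suc n) 0 (suc (toℕ i))
    ≡⟨ ℤ.+-identityˡ _ ⟩
  ∑[ i ≤ n ] signedCoeff (suc n) 0 (suc (toℕ i))
    ≡⟨ sum-cong-≗ {suc n} (λ i → shifted (toℕ i)) ⟩
  ∑[ i ≤ n ] (-1ℤ ℤ.* signedCoeff n 2 (toℕ i))
    ≡⟨ *-distribˡ-sum {suc n} -1ℤ (signedCoeff n 2 ∘ toℕ) ⟨
  -1ℤ ℤ.* alternatingSum n 2 ∎
  where
  exponent : ∀ i → 2 * suc i + 0 ≡ 2 * i + 2
  exponent i = trans (ℕ.+-identityʳ (2 * suc i)) (trans (ℕ.*-suc 2 i) (ℕ.+-comm 2 (2 * i)))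
  shifted : ∀ i → signedCoeff (suc n) 0 (suc i) ≡ -1ℤ ℤ.* signedCoeff n 2 i
  shifted i = trans (cong (λ k → -1ℤ ℤ.^ suc i ℤ.* a (n ∸ i) k) (exponent i))
                    (ℤ.*-assoc -1ℤ (-1ℤ ℤ.^ i) (a (n ∸ i) (2 * i + 2)))

alternatingSum-suc-1 : ∀ n →
  alternatingSum (suc n) 1 ≡ alternatingSum n 1 ℤ.+ alternatingSum (suc n) 0 ℤ.+ alternatingSum n 2
alternatingSum-suc-1 n = begin
  alternatingSum (suc n) 1
    ≡⟨ sum⁺-last n (signedCoeff (suc n) 1) ⟩
  ∑[ i ≤ n ] signedCoeff (suc n) 1 (toℕ i) ℤ.+ signedCoeff (suc n) 1 (suc n)
    ≡⟨ cong₂ ℤ._+_ (sum-cong-≗ {suc n} (λ i → signedCoeff-suc n (toℕ i) (toℕ≤pred[n] i)))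
                   (signedCoeff-diagonal (suc n) 1) ⟩
  ∑[ i ≤ n ] (signedCoeff n 1 (toℕ i) ℤ.+ signedCoeff (suc n) 0 (toℕ i) ℤ.+ signedCoeff n 2 (toℕ i))
    ℤ.+ -1ℤ ℤ.^ suc n
    ≡⟨ cong (ℤ._+ -1ℤ ℤ.^ suc n) split ⟩
  alternatingSum n 1 ℤ.+ lower ℤ.+ alternatingSum n 2 ℤ.+ -1ℤ ℤ.^ suc n
    ≡⟨ regroup (alternatingSum n 1) lower (alternatingSum n 2) (-1ℤ ℤ.^ suc n) ⟩
  alternatingSum n 1 ℤ.+ (lower ℤ.+ -1ℤ ℤ.^ suc n) ℤ.+ alternatingSum n 2
    ≡⟨ cong (λ x → alternatingSum n 1 ℤ.+ x ℤ.+ alternatingSum n 2)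
            (sym (trans (sum⁺-last n (signedCoeff (suc n) 0)) (cong (λ s → lower ℤ.+ s) (signedCoeff-diagonal (suc n) 0)))) ⟩
  alternatingSum n 1 ℤ.+ alternatingSum (suc n) 0 ℤ.+ alternatingSum n 2 ∎
  where
  lower = ∑[ i ≤ n ] signedCoeff (suc n) 0 (toℕ i)
  split : ∑[ i ≤ n ] (signedCoeff n 1 (toℕ i) ℤ.+ signedCoeff (suc n) 0 (toℕ i) ℤ.+ signedCoeff n 2 (toℕ i))
          ≡ alternatingSum n 1 ℤ.+ lower ℤ.+ alternatingSum n 2
  split = trans (∑-distrib-+ {suc n} (λ i → signedCoeff n 1 (toℕ i) ℤ.+ signedCoeff (suc n) 0 (toℕ i))
                                     (signedCoeff n 2 ∘ toℕ))
                (cong (ℤ._+ alternatingSum n 2)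
                      (∑-distrib-+ {suc n} (signedCoeff n 1 ∘ toℕ) (signedCoeff (suc n) 0 ∘ toℕ)))
  regroup : ∀ x y z w → x ℤ.+ y ℤ.+ z ℤ.+ w ≡ x ℤ.+ (y ℤ.+ w) ℤ.+ z
  regroup = solve-∀

alternatingSum-1 : ∀ n → alternatingSum n 1 ≡ 1ℤ
alternatingSum-1 zero    = refl
alternatingSum-1 (suc n) = begin
  alternatingSum (suc n) 1
    ≡⟨ alternatingSum-suc-1 n ⟩
  alternatingSum n 1 ℤ.+ alternatingSum (suc n) 0 ℤ.+ alternatingSum n 2
    ≡⟨ cong (λ x → alternatingSum n 1 ℤ.+ x ℤ.+ alternatingSum n 2) (alternatingSum-suc-0 n) ⟩
  alternatingSum n 1 ℤ.+ -1ℤ ℤ.* alternatingSum n 2 ℤ.+ alternatingSum n 2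
    ≡⟨ cancel (alternatingSum n 1) (alternatingSum n 2) ⟩
  alternatingSum n 1
    ≡⟨ alternatingSum-1 n ⟩
  1ℤ ∎
  where
  cancel : ∀ x y → x ℤ.+ -1ℤ ℤ.* y ℤ.+ y ≡ x
  cancel = solve-∀

theorem4p2 : (n : ℕ) → 1 ≤ n →
    Σ (FreeSchroderWithUp n → FreeSchroderWithUp n)
      (λ f → ((p : FreeSchroderWithUp n) → proj₁ (f (f p)) ≡ proj₁ p)
           × ((p : FreeSchroderWithUp n) →
                flawBlocks (proj₁ (f p)) % 2 ≢ flawBlocks (proj₁ p) % 2))
    × (altSum n ≡ 1ℤ)
theorem4p2 n _ =
  ( reflectFirstBlockWithUp {n}
  , (λ p → reflectFirstBlock-involutive (proj₁ p))
  , (λ (p , _ , up) → m≡1+n⊎n≡1+m⇒m%2≢n%2 _ _ (flawBlocks-reflectFirstBlock p up)) )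
  , trans (altSum≡alternatingSum n) (alternatingSum-1 n)
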